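{- Let $N\ge1$, $B_1,\dots,B_k,B\subseteq\{0,1,\dots,2^N-1\}$, $\alpha_i=\overline{(\sum^\circ_{j\in B_i}y_j^{(N)},N)}$ for $1\le i\le k$, $\Gamma=\{\alpha_1,\dots,\alpha_k\}$ and $\beta=\overline{(\sum^\circ_{j\in B}y_j^{(N)},N)}$ in $S_c[X]$. Then $\Gamma\vdash\beta$ if and only if $\bigcap_{i=1}^kB_i\subseteq B$.
   Context: A semiring is a set with operations $\circ$ (commutative monoid, identity $\theta$) and $\cdot$ (monoid, identity $1$), $\cdot$ distributing over $\circ$ on both sides, $\theta$ absorbing for $\cdot$, $1\ne\theta$. Let $X=\{x_1,x_2,\dots\}$ be countable. For $N\ge1$ let $S_c[X_N]$ be the quotient of the free commutative semiring on $\{x_1,\dots,x_N,x_1^c,\dots,x_N^c\}$ by the congruence generated by $(x_i\cdot x_i^c,\theta)$, $(x_i\circ x_i^c,1)$, $(x_i\circ x_i,x_i)$, $(x_i^c\circ x_i^c,x_i^c)$, $1\le i\le N$. For $k=\sum_{l=1}^N j_l2^{l-1}$, $j_l\in\{0,1\}$, put $y_k^{(N)}=x_1^{j_1}\cdots x_N^{j_N}$ with $x_l^1=x_l$, $x_l^0=x_l^c$; every element of $S_c[X_N]$ is uniquely $\sum^\circ_{k\in D}y_k^{(N)}$ with $D\subseteq\{0,\dots,2^N-1\}$ (empty sum $=\theta$). For $N\le M$ let $f_{NM}:S_c[X_N]\to S_c[X_M]$ be the homomorphism induced by $x_i\mapsto x_i,x_i^c\mapsto x_i^c$. $S_c[X]$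 (the free I-C semiring on $X$) is the direct limit: classes $\overline{(a,i)}$, $a\in S_c[X_i]$, with $(a,i)\sim(b,j)$ iff $f_{ik}(a)=f_{jk}(b)$ for some $k\ge i,j$, operations computed at a common level. For $\Gamma\subseteq S_c[X]$ let $\equiv_\Gamma$ be the congruence on $S_c[X]$ generated by $\{(\gamma,1):\gamma\in\Gamma\}$; $\Gamma\vdash\beta$ means $\beta\equiv_\Gamma1$. -}

module Defs where

open import Data.Nat using (ℕ; zero; suc; _≤_; _⊔_; _^_; _/_; _%_)
open import Data.Nat.Properties using (m≤m⊔n; m≤n⊔m)
open import Data.Fin using (Fin; toℕ; inject≤)
open import Data.Fin.Subset using (Subset; _∈_)
open import Data.Bool using (Bool; true; false; if_then_else_)
open import Data.List using (List; foldr; allFin; filter)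
open import Data.Product using (Σ; _,_)
open import Relation.Nullary using (Dec; yes; no)
open import Data.Fin.Subset.Properties using (_∈?_)

-- Terms of the free commutative semiring on {x_1..x_N, x_1^c..x_N^c}
-- (generators indexed 0-based by Fin N: x i  is  x_{i+1}).

infixl 6 _∘_
infixl 7 _·_

data Tm (N : ℕ) : Set where
  x  : Fin N → Tm N
  xc : Fin N → Tm N
  θ  : Tm N
  𝟙  : Tm N
  _∘_ : Tm N → Tm N → Tm N
  _·_ : Tm N → Tm N → Tm N

-- S_c[X_N]: terms modulo the congruence generated by the commutative
-- semiring axioms (giving the free commutative semiring) together with
-- the defining pairs  (x_i·x_i^c, θ), (x_i∘x_i^c, 1), (x_i∘x_i, x_i),
-- (x_i^c∘x_i^c, x_i^c).
infix 4 _≈_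
data _≈_ {N : ℕ} : Tm N → Tm N → Set where
  refl  : ∀ {a} → a ≈ a
  sym   : ∀ {a b} → a ≈ b → b ≈ a
  trans : ∀ {a b c} → a ≈ b → b ≈ c → a ≈ c
  ∘-cong : ∀ {a b c d} → a ≈ b → c ≈ d → a ∘ c ≈ b ∘ d
  ·-cong : ∀ {a b c d} → a ≈ b → c ≈ d → a · c ≈ b · d
  ∘-assoc : ∀ a b c → (a ∘ b) ∘ c ≈ a ∘ (b ∘ c)
  ∘-comm  : ∀ a b → a ∘ b ≈ b ∘ a
  ∘-idˡ   : ∀ a → θ ∘ a ≈ a
  ·-assoc : ∀ a b c → (a · b) · c ≈ a · (b · c)
  ·-comm  : ∀ a b → a · b ≈ b · a
  ·-idˡ   : ∀ a → 𝟙 · a ≈ a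
  distribˡ : ∀ a b c → a · (b ∘ c) ≈ (a · b) ∘ (a · c)
  distribʳ : ∀ a b c → (b ∘ c) · a ≈ (b · a) ∘ (c · a)
  zeroˡ   : ∀ a → θ · a ≈ θ
  zeroʳ   : ∀ a → a · θ ≈ θ
  compl-· : ∀ i → x i · xc i ≈ θ
  compl-∘ : ∀ i → x i ∘ xc i ≈ 𝟙
  idem    : ∀ i → x i ∘ x i ≈ x i
  idemᶜ   : ∀ i → xc i ∘ xc i ≈ xc i

f : ∀ {N M} → N ≤ M → Tm N → Tm M
f p (x i)   = x (inject≤ i p)
f p (xc i)  = xc (inject≤ i p)
f p θ       = θ
f p 𝟙       = 𝟙
f p (a ∘ b) = f p a ∘ f p b
f p (a · b) = f p a · f p b

-- bit l of n (l = 0 is the least significant bit)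
bit : ℕ → ℕ → Bool
bit n zero    with n % 2
... | zero  = false
... | suc _ = true
bit n (suc l) = bit (n / 2) l

-- y_k = x_1^{j_1} ⋯ x_N^{j_N}, j_l = bit (l-1) of k
y : (N : ℕ) → Fin (2 ^ N) → Tm N
y N k = foldr (λ l t → (if bit (toℕ k) (toℕ l) then x l else xc l) · t) 𝟙 (allFin N)

sumY : (N : ℕ) → Subset (2 ^ N) → Tm N
sumY N D = foldr (λ k t → y N k ∘ t) θ (filter (λ k → k ∈? D) (allFin (2 ^ N)))

-- The direct limit S_c[X]: elements are pairs (a , i), a ∈ S_c[X_i].

record El : Set where
  constructor ⟨_,_⟩
  field
    lvl : ℕ
    tm  : Tm lvl

infix 4 _∼_
_∼_ : El → El → Set
⟨ i , a ⟩ ∼ ⟨ j , b ⟩ =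
  Σ ℕ λ k → Σ (i ≤ k) λ p → Σ (j ≤ k) λ q → f p a ≈ f q b

_∘L_ : El → El → El
⟨ i , a ⟩ ∘L ⟨ j , b ⟩ = ⟨ i ⊔ j , f (m≤m⊔n i j) a ∘ f (m≤n⊔m i j) b ⟩

_·L_ : El → El → El
⟨ i , a ⟩ ·L ⟨ j , b ⟩ = ⟨ i ⊔ j , f (m≤m⊔n i j) a · f (m≤n⊔m i j) b ⟩

oneL : El
oneL = ⟨ 1 , 𝟙 ⟩

elem : (N : ℕ) → Subset (2 ^ N) → El
elem N D = ⟨ N , sumY N D ⟩

-- ≡_Γ : congruence on S_c[X] generated by {(γ,1) : γ ∈ Γ},
-- Γ = {γ_1, …, γ_k} given as a family Fin k → El.

data Cong {k : ℕ} (Γ : Fin k → El) : El → El → Set where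
  gen   : ∀ i → Cong Γ (Γ i) oneL
  lim   : ∀ {a b} → a ∼ b → Cong Γ a b
  sym   : ∀ {a b} → Cong Γ a b → Cong Γ b a
  trans : ∀ {a b c} → Cong Γ a b → Cong Γ b c → Cong Γ a c
  ∘-cong : ∀ {a b c d} → Cong Γ a b → Cong Γ c d → Cong Γ (a ∘L c) (b ∘L d)
  ·-cong : ∀ {a b c d} → Cong Γ a b → Cong Γ c d → Cong Γ (a ·L c) (b ·L d)

_⊢_ : {k : ℕ} → (Fin k → El) → El → Set
Γ ⊢ β = Cong Γ β oneL

{-# OPTIONS --safe #-}
-- S_c[X_M] is the free Boolean algebra on x_1, …, x_M.  Evaluation in Bool respects ≈, and
-- conversely, writing a truth table g as the term nf g obtained by Shannon expansion
-- x_v · g|_{x_v = 1} ∘ x_v^c · g|_{x_v = 0} along all variables, every term t satisfies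
-- t ≈ nf ⟦ t ⟧; so terms with the same truth table are equal.  Hence Γ ⊢ β iff every valuation
-- satisfying Γ satisfies β: in that case β = β ∘ ∏Γ holds in S_c[X], and ∏Γ ≡_Γ 1.
-- A valuation ρ satisfies exactly one minterm y_k^{(N)}, the one whose index k has the binary
-- digits ρ(x_1), …, ρ(x_N); so ρ satisfies Σ°_{k∈D} y_k^{(N)} iff k ∈ D, and the semantic
-- condition becomes ⋂ B_i ⊆ B.
module Submission where

open import Defs
open import Algebra using (CommutativeSemiring; isCommutativeSemiringˡ; isCommutativeMonoidˡ)
import Algebra.Properties.CommutativeSemigroup as CommutativeSemigroupProperties
open import Data.Bool using (Bool; true; false; not; _∧_; _∨_; T; if_then_else_)
open import Data.Unit using (tt)
open import Data.Empty using (⊥-elim)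
open import Data.Bool.Properties using (T-≡; T-not-≡; T-∧; T-∨; ∨-assoc; ∨-comm; ∨-idem; ∨-inverseʳ; ∨-zeroʳ; ∧-assoc; ∧-comm; ∧-zeroʳ; ∧-inverseʳ; ∧-distribˡ-∨; ∧-distribʳ-∨)
open import Data.Fin using (Fin; zero; suc; toℕ; inject≤; fromℕ<; _≟_)
open import Data.Fin.Properties using (toℕ-inject≤; toℕ-fromℕ<; toℕ<n; toℕ-injective)
open import Data.List using (List; []; _∷_; allFin; foldr; tabulate)
open import Data.List.Relation.Unary.All using (All; []; _∷_)
import Data.List.Relation.Unary.All.Properties as All
open import Data.List.Relation.Unary.Any as Any using (Any; here; there)
open import Data.Fin.Subset using (Subset; _∈_; _⊆_; ⋂)
open import Data.Fin.Subset.Properties using (_∈?_; ∈⊤; x∈p∩q⁺; x∈p∩q⁻)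
open import Data.List.Membership.Propositional using () renaming (_∈_ to _∈ˡ_)
open import Data.List.Membership.Propositional.Properties using (∈-allFin; ∈-filter⁺; ∈-filter⁻)
open import Data.Nat using (ℕ; zero; suc; _≤_; _<_; _^_; _+_; _*_; _/_; _%_; _⊔_; s≤s; z≤n)
open import Data.Nat.DivMod using (m≡m%n+[m/n]*n; m%n<n; [m+kn]%n≡m%n; m<n⇒m%n≡m; +-distrib-/-∣ʳ; m<n⇒m/n≡0; m*n/n≡m; m<n*o⇒m/o<n)
open import Data.Nat.Divisibility using (n∣m*n)
open import Data.Nat.Properties using (≤-pred; ≤-refl; ≤-trans; m≤m⊔n; m≤n⊔m; n≤1+n; n<1⇒n≡0; +-monoˡ-≤; *-monoˡ-≤; *-comm; module ≤-Reasoning)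
open import Data.Product using (_×_; _,_; proj₁; proj₂)
open import Data.Sum using (inj₁; inj₂; [_,_]′)
open import Data.Vec.Functional using (updateAt)
open import Data.Vec.Functional.Properties using (updateAt-updates; updateAt-minimal)
open import Function using (const; id; _∘′_)
open import Function.Bundles using (_⇔_; mk⇔; Equivalence)
open Equivalence using (to; from)
import Data.Vec.Functional as Vector
open import Function.Construct.Composition using (_⇔-∘_)
open import Level using (0ℓ)
open import Relation.Binary.Structures using (IsEquivalence)
import Relation.Binary.PropositionalEquality as ≡
open ≡ using (_≡_; cong; cong₂)
import Relation.Binary.Reasoning.Setoid as SetoidReasoning
open import Relation.Nullary using (yes; no)

private
  variable
    M N k : ℕ
    Γ : Fin k → El
    β : El
    v : Fin M
    a b c d u w : Tm M
    vs : List (Fin M)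
    g h : (Fin M → Bool) → Bool

-- S_c[X_M] as a Boolean algebra

≈-isEquivalence : IsEquivalence (_≈_ {M})
≈-isEquivalence = record { refl = refl ; sym = sym ; trans = trans }

commutativeSemiring : ℕ → CommutativeSemiring 0ℓ 0ℓ
commutativeSemiring M = record
  { Carrier = Tm M
  ; _≈_     = _≈_
  ; _+_     = _∘_
  ; _*_     = _·_
  ; 0#      = θ
  ; 1#      = 𝟙
  ; isCommutativeSemiring = isCommutativeSemiringˡ record
    { +-isCommutativeMonoid = isCommutativeMonoidˡ record
      { isSemigroup = record
        { isMagma = record { isEquivalence = ≈-isEquivalence ; ∙-cong = ∘-cong }
        ; assoc   = ∘-assoc
        }
      ; identityˡ = ∘-idˡ
      ; comm      = ∘-comm
      }
    ; *-isCommutativeMonoid = isCommutativeMonoidˡ record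
      { isSemigroup = record
        { isMagma = record { isEquivalence = ≈-isEquivalence ; ∙-cong = ·-cong }
        ; assoc   = ·-assoc
        }
      ; identityˡ = ·-idˡ
      ; comm      = ·-comm
      }
    ; distribʳ = distribʳ
    ; zeroˡ    = zeroˡ
    }
  }

module _ {M : ℕ} where
  open CommutativeSemiring (commutativeSemiring M) public
    using (setoid; reflexive) renaming (+-identityʳ to ∘-idʳ; *-identityʳ to ·-idʳ)
  open CommutativeSemigroupProperties (CommutativeSemiring.+-commutativeSemigroup (commutativeSemiring M)) public
    using () renaming (interchange to ∘-interchange)
  open CommutativeSemigroupProperties (CommutativeSemiring.*-commutativeSemigroup (commutativeSemiring M)) public
    using () renaming (interchange to ·-interchange)

module ≈-Reasoning {M : ℕ} = SetoidReasoning (setoid {M})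

·-idem-of-complement : u · w ≈ θ → u ∘ w ≈ 𝟙 → u · u ≈ u
·-idem-of-complement {u = u} {w} u·w≈θ u∘w≈𝟙 = sym (begin
  u                 ≈⟨ sym (·-idʳ u) ⟩
  u · 𝟙             ≈⟨ ·-cong refl (sym u∘w≈𝟙) ⟩
  u · (u ∘ w)       ≈⟨ distribˡ u u w ⟩
  u · u ∘ u · w     ≈⟨ ∘-cong refl u·w≈θ ⟩
  u · u ∘ θ         ≈⟨ ∘-idʳ (u · u) ⟩
  u · u             ∎)
  where open ≈-Reasoning

x·x≈x : (v : Fin M) → x v · x v ≈ x v
x·x≈x v = ·-idem-of-complement (compl-· v) (compl-∘ v)

xc·x≈θ : (v : Fin M) → xc v · x v ≈ θ
xc·x≈θ v = trans (·-comm (xc v) (x v)) (compl-· v)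

xc·xc≈xc : (v : Fin M) → xc v · xc v ≈ xc v
xc·xc≈xc v = ·-idem-of-complement (xc·x≈θ v) (trans (∘-comm (xc v) (x v)) (compl-∘ v))

-- The variable is necessary: S_c[X_0] is ℕ, where 1 + 1 ≠ 1.
𝟙∘𝟙≈𝟙 : Fin M → 𝟙 ∘ 𝟙 ≈ 𝟙
𝟙∘𝟙≈𝟙 v = begin
  𝟙 ∘ 𝟙                         ≈⟨ sym (∘-cong (compl-∘ v) (compl-∘ v)) ⟩
  (x v ∘ xc v) ∘ (x v ∘ xc v)   ≈⟨ ∘-interchange (x v) (xc v) (x v) (xc v) ⟩
  (x v ∘ x v) ∘ (xc v ∘ xc v)   ≈⟨ ∘-cong (idem v) (idemᶜ v) ⟩
  x v ∘ xc v                    ≈⟨ compl-∘ v ⟩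
  𝟙                             ∎
  where open ≈-Reasoning

ite : Fin M → Tm M → Tm M → Tm M
ite v a b = x v · a ∘ xc v · b

ite-cong : a ≈ c → b ≈ d → ite v a b ≈ ite v c d
ite-cong a≈c b≈d = ∘-cong (·-cong refl a≈c) (·-cong refl b≈d)

ite-same : (v : Fin M) (a : Tm M) → ite v a a ≈ a
ite-same v a = trans (sym (distribʳ a (x v) (xc v))) (trans (·-cong (compl-∘ v) refl) (·-idˡ a))

ite-𝟙-θ : (v : Fin M) → ite v 𝟙 θ ≈ x v
ite-𝟙-θ v = trans (∘-cong (·-idʳ (x v)) (zeroʳ (xc v))) (∘-idʳ (x v))

ite-θ-𝟙 : (v : Fin M) → ite v θ 𝟙 ≈ xc v
ite-θ-𝟙 v = trans (∘-cong (zeroʳ (x v)) (·-idʳ (xc v))) (∘-idˡ (xc v))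

ite-∘ : (v : Fin M) (a b c d : Tm M) → ite v a b ∘ ite v c d ≈ ite v (a ∘ c) (b ∘ d)
ite-∘ v a b c d = trans (∘-interchange (x v · a) (xc v · b) (x v · c) (xc v · d))
                        (sym (∘-cong (distribˡ (x v) a c) (distribˡ (xc v) b d)))

ite-· : (v : Fin M) (a b c d : Tm M) → ite v a b · ite v c d ≈ ite v (a · c) (b · d)
ite-· v a b c d = begin
  (x v · a ∘ xc v · b) · (x v · c ∘ xc v · d)
    ≈⟨ trans (distribʳ _ _ _) (∘-cong (distribˡ _ _ _) (distribˡ _ _ _)) ⟩
  ((x v · a) · (x v · c) ∘ (x v · a) · (xc v · d)) ∘ ((xc v · b) · (x v · c) ∘ (xc v · b) · (xc v · d))
    ≈⟨ ∘-cong (∘-cong (·-interchange _ _ _ _) (·-interchange _ _ _ _))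
              (∘-cong (·-interchange _ _ _ _) (·-interchange _ _ _ _)) ⟩
  ((x v · x v) · (a · c) ∘ (x v · xc v) · (a · d)) ∘ ((xc v · x v) · (b · c) ∘ (xc v · xc v) · (b · d))
    ≈⟨ ∘-cong (∘-cong (·-cong (x·x≈x v) refl) (trans (·-cong (compl-· v) refl) (zeroˡ _)))
              (∘-cong (trans (·-cong (xc·x≈θ v) refl) (zeroˡ _)) (·-cong (xc·xc≈xc v) refl)) ⟩
  (x v · (a · c) ∘ θ) ∘ (θ ∘ xc v · (b · d))
    ≈⟨ ∘-cong (∘-idʳ _) (∘-idˡ _) ⟩
  ite v (a · c) (b · d) ∎
  where open ≈-Reasoning

⟦_⟧ : Tm M → (Fin M → Bool) → Bool
⟦ x v ⟧   ρ = ρ v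
⟦ xc v ⟧  ρ = not (ρ v)
⟦ θ ⟧     ρ = false
⟦ 𝟙 ⟧     ρ = true
⟦ a ∘ b ⟧ ρ = ⟦ a ⟧ ρ ∨ ⟦ b ⟧ ρ
⟦ a · b ⟧ ρ = ⟦ a ⟧ ρ ∧ ⟦ b ⟧ ρ

⟦⟧-resp-≈ : a ≈ b → ∀ ρ → ⟦ a ⟧ ρ ≡ ⟦ b ⟧ ρ
⟦⟧-resp-≈ refl                 ρ = ≡.refl
⟦⟧-resp-≈ (sym a≈b)            ρ = ≡.sym (⟦⟧-resp-≈ a≈b ρ)
⟦⟧-resp-≈ (trans a≈b b≈c)      ρ = ≡.trans (⟦⟧-resp-≈ a≈b ρ) (⟦⟧-resp-≈ b≈c ρ)
⟦⟧-resp-≈ (∘-cong a≈b c≈d)     ρ = cong₂ _∨_ (⟦⟧-resp-≈ a≈b ρ) (⟦⟧-resp-≈ c≈d ρ)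
⟦⟧-resp-≈ (·-cong a≈b c≈d)     ρ = cong₂ _∧_ (⟦⟧-resp-≈ a≈b ρ) (⟦⟧-resp-≈ c≈d ρ)
⟦⟧-resp-≈ (∘-assoc a b c)      ρ = ∨-assoc (⟦ a ⟧ ρ) (⟦ b ⟧ ρ) (⟦ c ⟧ ρ)
⟦⟧-resp-≈ (∘-comm a b)         ρ = ∨-comm (⟦ a ⟧ ρ) (⟦ b ⟧ ρ)
⟦⟧-resp-≈ (∘-idˡ a)            ρ = ≡.refl
⟦⟧-resp-≈ (·-assoc a b c)      ρ = ∧-assoc (⟦ a ⟧ ρ) (⟦ b ⟧ ρ) (⟦ c ⟧ ρ)
⟦⟧-resp-≈ (·-comm a b)         ρ = ∧-comm (⟦ a ⟧ ρ) (⟦ b ⟧ ρ)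
⟦⟧-resp-≈ (·-idˡ a)            ρ = ≡.refl
⟦⟧-resp-≈ (distribˡ a b c)     ρ = ∧-distribˡ-∨ (⟦ a ⟧ ρ) (⟦ b ⟧ ρ) (⟦ c ⟧ ρ)
⟦⟧-resp-≈ (distribʳ a b c)     ρ = ∧-distribʳ-∨ (⟦ a ⟧ ρ) (⟦ b ⟧ ρ) (⟦ c ⟧ ρ)
⟦⟧-resp-≈ (zeroˡ a)            ρ = ≡.refl
⟦⟧-resp-≈ (zeroʳ a)            ρ = ∧-zeroʳ (⟦ a ⟧ ρ)
⟦⟧-resp-≈ (compl-· v)          ρ = ∧-inverseʳ (ρ v)
⟦⟧-resp-≈ (compl-∘ v)          ρ = ∨-inverseʳ (ρ v)
⟦⟧-resp-≈ (idem v)             ρ = ∨-idem (ρ v)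
⟦⟧-resp-≈ (idemᶜ v)            ρ = ∨-idem (not (ρ v))

⌜_⌝ : Bool → Tm M
⌜ true ⌝  = 𝟙
⌜ false ⌝ = θ

⌜⌝-∨ : Fin M → ∀ p q → ⌜ p ⌝ ∘ ⌜ q ⌝ ≈ ⌜_⌝ {M} (p ∨ q)
⌜⌝-∨ v true  true  = 𝟙∘𝟙≈𝟙 v
⌜⌝-∨ v true  false = ∘-idʳ 𝟙
⌜⌝-∨ v false q     = ∘-idˡ ⌜ q ⌝

⌜⌝-∧ : ∀ p q → ⌜ p ⌝ · ⌜ q ⌝ ≈ ⌜_⌝ {M} (p ∧ q)
⌜⌝-∧ true  q = ·-idˡ ⌜ q ⌝
⌜⌝-∧ false q = zeroˡ ⌜ q ⌝

_[_≔_] : (Fin M → Bool) → Fin M → Bool → Fin M → Bool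
ρ [ v ≔ p ] = updateAt ρ v (const p)

-- The Shannon expansion of g along vs; it represents g when g depends only on the variables in vs.
nf : List (Fin M) → ((Fin M → Bool) → Bool) → Tm M
nf []       g = ⌜ g (const false) ⌝
nf (v ∷ vs) g = ite v (nf vs (λ ρ → g (ρ [ v ≔ true ]))) (nf vs (λ ρ → g (ρ [ v ≔ false ])))

nf-cong : (vs : List (Fin M)) → (∀ ρ → g ρ ≡ h ρ) → nf vs g ≡ nf vs h
nf-cong []       g≗h = cong ⌜_⌝ (g≗h (const false))
nf-cong (v ∷ vs) g≗h = cong₂ (ite v) (nf-cong vs (λ ρ → g≗h (ρ [ v ≔ true ])))
                                    (nf-cong vs (λ ρ → g≗h (ρ [ v ≔ false ])))

nf-const : (vs : List (Fin M)) (p : Bool) → nf vs (const p) ≈ ⌜ p ⌝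
nf-const []       p = refl
nf-const (v ∷ vs) p = trans (ite-cong (nf-const vs p) (nf-const vs p)) (ite-same v ⌜ p ⌝)

nf-∨ : Fin M → (vs : List (Fin M)) (g h : (Fin M → Bool) → Bool) →
       nf vs g ∘ nf vs h ≈ nf vs (λ ρ → g ρ ∨ h ρ)
nf-∨ v₀ []       g h = ⌜⌝-∨ v₀ (g (const false)) (h (const false))
nf-∨ v₀ (v ∷ vs) g h = trans (ite-∘ v _ _ _ _) (ite-cong (nf-∨ v₀ vs _ _) (nf-∨ v₀ vs _ _))

nf-∧ : (vs : List (Fin M)) (g h : (Fin M → Bool) → Bool) →
       nf vs g · nf vs h ≈ nf vs (λ ρ → g ρ ∧ h ρ)
nf-∧ []       g h = ⌜⌝-∧ (g (const false)) (h (const false))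
nf-∧ (v ∷ vs) g h = trans (ite-· v _ _ _ _) (ite-cong (nf-∧ vs _ _) (nf-∧ vs _ _))

nf-literal : v ∈ˡ vs → (φ : Bool → Bool) → ite v ⌜ φ true ⌝ ⌜ φ false ⌝ ≈ nf vs (λ ρ → φ (ρ v))
nf-literal {v = v} {vs = w ∷ vs} v∈w∷vs φ with v ≟ w
... | yes ≡.refl = ite-cong (fixed true) (fixed false)
  where
  fixed : ∀ p → ⌜ φ p ⌝ ≈ nf vs (λ ρ → φ ((ρ [ v ≔ p ]) v))
  fixed p = sym (trans (reflexive (nf-cong vs (λ ρ → cong φ (updateAt-updates v ρ)))) (nf-const vs (φ p)))
... | no v≢w = begin
  ite v ⌜ φ true ⌝ ⌜ φ false ⌝                      ≈⟨ sym (ite-same w _) ⟩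
  ite w (ite v ⌜ φ true ⌝ ⌜ φ false ⌝) (ite v ⌜ φ true ⌝ ⌜ φ false ⌝)
    ≈⟨ ite-cong (nf-literal (Any.tail v≢w v∈w∷vs) φ) (nf-literal (Any.tail v≢w v∈w∷vs) φ) ⟩
  ite w (nf vs (λ ρ → φ (ρ v))) (nf vs (λ ρ → φ (ρ v)))
    ≈⟨ reflexive (cong₂ (ite w) (unaffected true) (unaffected false)) ⟩
  nf (w ∷ vs) (λ ρ → φ (ρ v))                         ∎
  where
  open ≈-Reasoning
  unaffected : ∀ p → nf vs (λ ρ → φ (ρ v)) ≡ nf vs (λ ρ → φ ((ρ [ w ≔ p ]) v))
  unaffected p = nf-cong vs (λ ρ → cong φ (≡.sym (updateAt-minimal v w ρ v≢w)))

nf-correct : {M : ℕ} → Fin M → (t : Tm M) → t ≈ nf (allFin M) ⟦ t ⟧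
nf-correct     v₀ (x v)   = trans (sym (ite-𝟙-θ v)) (nf-literal (∈-allFin v) id)
nf-correct     v₀ (xc v)  = trans (sym (ite-θ-𝟙 v)) (nf-literal (∈-allFin v) not)
nf-correct {M} v₀ θ       = sym (nf-const (allFin M) false)
nf-correct {M} v₀ 𝟙       = sym (nf-const (allFin M) true)
nf-correct {M} v₀ (a ∘ b) = trans (∘-cong (nf-correct v₀ a) (nf-correct v₀ b)) (nf-∨ v₀ (allFin M) ⟦ a ⟧ ⟦ b ⟧)
nf-correct {M} v₀ (a · b) = trans (·-cong (nf-correct v₀ a) (nf-correct v₀ b)) (nf-∧ (allFin M) ⟦ a ⟧ ⟦ b ⟧)

≈-complete : {M : ℕ} → Fin M → (a b : Tm M) → (∀ ρ → ⟦ a ⟧ ρ ≡ ⟦ b ⟧ ρ) → a ≈ b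
≈-complete {M} v₀ a b ⟦a⟧≗⟦b⟧ =
  trans (nf-correct v₀ a) (trans (reflexive (nf-cong (allFin M) ⟦a⟧≗⟦b⟧)) (sym (nf-correct v₀ b)))

-- The direct limit S_c[X] and semantic consequence

⟦f⟧ : {ρ : Fin M → Bool} {σ : Fin N → Bool} (p : N ≤ M) (a : Tm N) →
      (∀ l → ρ (inject≤ l p) ≡ σ l) → ⟦ f p a ⟧ ρ ≡ ⟦ a ⟧ σ
⟦f⟧ p (x v)   ρ≗σ = ρ≗σ v
⟦f⟧ p (xc v)  ρ≗σ = cong not (ρ≗σ v)
⟦f⟧ p θ       ρ≗σ = ≡.refl
⟦f⟧ p 𝟙       ρ≗σ = ≡.refl
⟦f⟧ p (a ∘ b) ρ≗σ = cong₂ _∨_ (⟦f⟧ p a ρ≗σ) (⟦f⟧ p b ρ≗σ)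
⟦f⟧ p (a · b) ρ≗σ = cong₂ _∧_ (⟦f⟧ p a ρ≗σ) (⟦f⟧ p b ρ≗σ)

⟦_⟧ᴱ : El → (ℕ → Bool) → Bool
⟦ ⟨ i , a ⟩ ⟧ᴱ ρ = ⟦ a ⟧ (λ l → ρ (toℕ l))

⟦f⟧ᴱ : (p : N ≤ M) (a : Tm N) (ρ : ℕ → Bool) → ⟦ ⟨ M , f p a ⟩ ⟧ᴱ ρ ≡ ⟦ ⟨ N , a ⟩ ⟧ᴱ ρ
⟦f⟧ᴱ p a ρ = ⟦f⟧ p a (λ l → cong ρ (toℕ-inject≤ l p))

⟦∘L⟧ : (a b : El) (ρ : ℕ → Bool) → ⟦ a ∘L b ⟧ᴱ ρ ≡ ⟦ a ⟧ᴱ ρ ∨ ⟦ b ⟧ᴱ ρ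
⟦∘L⟧ ⟨ i , a ⟩ ⟨ j , b ⟩ ρ = cong₂ _∨_ (⟦f⟧ᴱ (m≤m⊔n i j) a ρ) (⟦f⟧ᴱ (m≤n⊔m i j) b ρ)

⟦·L⟧ : (a b : El) (ρ : ℕ → Bool) → ⟦ a ·L b ⟧ᴱ ρ ≡ ⟦ a ⟧ᴱ ρ ∧ ⟦ b ⟧ᴱ ρ
⟦·L⟧ ⟨ i , a ⟩ ⟨ j , b ⟩ ρ = cong₂ _∧_ (⟦f⟧ᴱ (m≤m⊔n i j) a ρ) (⟦f⟧ᴱ (m≤n⊔m i j) b ρ)

T-⟦·L⟧ : (a b : El) (ρ : ℕ → Bool) → T (⟦ a ·L b ⟧ᴱ ρ) → T (⟦ a ⟧ᴱ ρ) × T (⟦ b ⟧ᴱ ρ)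
T-⟦·L⟧ a b ρ = to T-∧ ∘′ ≡.subst T (⟦·L⟧ a b ρ)

∼-refl : (a : El) → a ∼ a
∼-refl ⟨ i , a ⟩ = i , ≤-refl , ≤-refl , refl

∼-sound : {a b : El} → a ∼ b → ∀ ρ → ⟦ a ⟧ᴱ ρ ≡ ⟦ b ⟧ᴱ ρ
∼-sound {⟨ i , a ⟩} {⟨ j , b ⟩} (_ , p , q , fa≈fb) ρ =
  ≡.trans (≡.sym (⟦f⟧ᴱ p a ρ)) (≡.trans (⟦⟧-resp-≈ fa≈fb _) (⟦f⟧ᴱ q b ρ))

extend : (Fin N → Bool) → ℕ → Bool
extend {zero}  σ n       = false
extend {suc N} σ zero    = σ zero
extend {suc N} σ (suc n) = extend (λ l → σ (suc l)) n

extend-toℕ : (σ : Fin N → Bool) (l : Fin N) → extend σ (toℕ l) ≡ σ l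
extend-toℕ σ zero    = ≡.refl
extend-toℕ σ (suc l) = extend-toℕ (λ l → σ (suc l)) l

∼-complete : (a b : El) → (∀ ρ → ⟦ a ⟧ᴱ ρ ≡ ⟦ b ⟧ᴱ ρ) → a ∼ b
∼-complete ⟨ i , a ⟩ ⟨ j , b ⟩ ⟦a⟧≗⟦b⟧ = suc (i ⊔ j) , p , q ,
  ≈-complete zero (f p a) (f q b) (λ σ → ≡.trans (⟦f⟧-extend p a σ) (≡.trans (⟦a⟧≗⟦b⟧ (extend σ)) (≡.sym (⟦f⟧-extend q b σ))))
  where
  -- One level above i ⊔ j there is a variable, as ≈-complete requires.
  p : i ≤ suc (i ⊔ j)
  p = ≤-trans (m≤m⊔n i j) (n≤1+n _)
  q : j ≤ suc (i ⊔ j)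
  q = ≤-trans (m≤n⊔m i j) (n≤1+n _)
  ⟦f⟧-extend : (r : N ≤ M) (c : Tm N) (σ : Fin M → Bool) → ⟦ f r c ⟧ σ ≡ ⟦ ⟨ N , c ⟩ ⟧ᴱ (extend σ)
  ⟦f⟧-extend r c σ = ⟦f⟧ r c (λ l → ≡.trans (≡.sym (extend-toℕ σ (inject≤ l r))) (cong (extend σ) (toℕ-inject≤ l r)))

_⊨_ : (Fin k → El) → El → Set
Γ ⊨ β = ∀ ρ → (∀ i → T (⟦ Γ i ⟧ᴱ ρ)) → T (⟦ β ⟧ᴱ ρ)

Cong-sound : {a b : El} → Cong Γ a b → ∀ ρ → (∀ i → T (⟦ Γ i ⟧ᴱ ρ)) → ⟦ a ⟧ᴱ ρ ≡ ⟦ b ⟧ᴱ ρ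
Cong-sound (gen i)         ρ ⊨Γ = to T-≡ (⊨Γ i)
Cong-sound (lim a∼b)       ρ ⊨Γ = ∼-sound a∼b ρ
Cong-sound (sym a≡b)       ρ ⊨Γ = ≡.sym (Cong-sound a≡b ρ ⊨Γ)
Cong-sound (trans a≡b b≡c) ρ ⊨Γ = ≡.trans (Cong-sound a≡b ρ ⊨Γ) (Cong-sound b≡c ρ ⊨Γ)
Cong-sound (∘-cong {a} {b} {c} {d} a≡b c≡d) ρ ⊨Γ = begin
  ⟦ a ∘L c ⟧ᴱ ρ          ≡⟨ ⟦∘L⟧ a c ρ ⟩
  ⟦ a ⟧ᴱ ρ ∨ ⟦ c ⟧ᴱ ρ    ≡⟨ cong₂ _∨_ (Cong-sound a≡b ρ ⊨Γ) (Cong-sound c≡d ρ ⊨Γ) ⟩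
  ⟦ b ⟧ᴱ ρ ∨ ⟦ d ⟧ᴱ ρ    ≡⟨ ⟦∘L⟧ b d ρ ⟨
  ⟦ b ∘L d ⟧ᴱ ρ          ∎
  where open ≡.≡-Reasoning
Cong-sound (·-cong {a} {b} {c} {d} a≡b c≡d) ρ ⊨Γ = begin
  ⟦ a ·L c ⟧ᴱ ρ          ≡⟨ ⟦·L⟧ a c ρ ⟩
  ⟦ a ⟧ᴱ ρ ∧ ⟦ c ⟧ᴱ ρ    ≡⟨ cong₂ _∧_ (Cong-sound a≡b ρ ⊨Γ) (Cong-sound c≡d ρ ⊨Γ) ⟩
  ⟦ b ⟧ᴱ ρ ∧ ⟦ d ⟧ᴱ ρ    ≡⟨ ⟦·L⟧ b d ρ ⟨
  ⟦ b ·L d ⟧ᴱ ρ          ∎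
  where open ≡.≡-Reasoning

⊢-sound : Γ ⊢ β → Γ ⊨ β
⊢-sound Γ⊢β ρ ⊨Γ = from T-≡ (Cong-sound Γ⊢β ρ ⊨Γ)

∏ : (Fin k → El) → El
∏ = Vector.foldr _·L_ oneL

⊢-∏ : {m : ℕ} (Δ : Fin m → El) → (∀ i → Γ ⊢ Δ i) → Γ ⊢ ∏ Δ
⊢-∏ {m = zero}  Δ Γ⊢Δ = lim (∼-refl oneL)
⊢-∏ {m = suc m} Δ Γ⊢Δ = trans (·-cong (Γ⊢Δ zero) (⊢-∏ (λ i → Δ (suc i)) (λ i → Γ⊢Δ (suc i)))) (lim 1·1∼1)
  where
  1·1∼1 : oneL ·L oneL ∼ oneL
  1·1∼1 = 1 , ≤-refl , ≤-refl , ·-idˡ 𝟙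

T-⟦∏⟧ : (Δ : Fin k → El) (ρ : ℕ → Bool) → T (⟦ ∏ Δ ⟧ᴱ ρ) → ∀ i → T (⟦ Δ i ⟧ᴱ ρ)
T-⟦∏⟧ {suc k} Δ ρ ∏Δ zero    = proj₁ (T-⟦·L⟧ (Δ zero) (∏ (λ i → Δ (suc i))) ρ ∏Δ)
T-⟦∏⟧ {suc k} Δ ρ ∏Δ (suc i) = T-⟦∏⟧ (λ i → Δ (suc i)) ρ (proj₂ (T-⟦·L⟧ (Δ zero) (∏ (λ i → Δ (suc i))) ρ ∏Δ)) i

p∨q≡p : ∀ p q → (T q → T p) → p ∨ q ≡ p
p∨q≡p true  q     _   = ≡.refl
p∨q≡p false false _   = ≡.refl
p∨q≡p false true  q⇒p = ⊥-elim (q⇒p tt)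

⊢-complete : Γ ⊨ β → Γ ⊢ β
⊢-complete {Γ = Γ} {β} Γ⊨β = trans (lim β∼β∘∏Γ) (trans (∘-cong (lim (∼-refl β)) (⊢-∏ Γ gen)) (lim β∘1∼1))
  where
  β∼β∘∏Γ : β ∼ β ∘L ∏ Γ
  β∼β∘∏Γ = ∼-complete β (β ∘L ∏ Γ) λ ρ →
    ≡.sym (≡.trans (⟦∘L⟧ β (∏ Γ) ρ) (p∨q≡p _ _ (Γ⊨β ρ ∘′ T-⟦∏⟧ Γ ρ)))
  β∘1∼1 : β ∘L oneL ∼ oneL
  β∘1∼1 = ∼-complete (β ∘L oneL) oneL (λ ρ → ≡.trans (⟦∘L⟧ β oneL ρ) (∨-zeroʳ _))

⊢⇔⊨ : Γ ⊢ β ⇔ Γ ⊨ β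
⊢⇔⊨ = mk⇔ ⊢-sound ⊢-complete

-- Minterms

fromBit : Bool → ℕ
fromBit false = 0
fromBit true  = 1

fromBit<2 : ∀ b → fromBit b < 2
fromBit<2 false = s≤s z≤n
fromBit<2 true  = s≤s (s≤s z≤n)

fromBit-injective : ∀ {b c} → fromBit b ≡ fromBit c → b ≡ c
fromBit-injective {false} {false} _ = ≡.refl
fromBit-injective {true}  {true}  _ = ≡.refl

m%2≡bit0 : ∀ m → m % 2 ≡ fromBit (bit m 0)
m%2≡bit0 m with m % 2 | m%n<n m 2
... | 0           | _               = ≡.refl
... | 1           | _               = ≡.refl
... | suc (suc _) | s≤s (s≤s ())

m≡bit0+[m/2]*2 : ∀ m → m ≡ fromBit (bit m 0) + m / 2 * 2
m≡bit0+[m/2]*2 m = ≡.trans (m≡m%n+[m/n]*n m 2) (cong (_+ m / 2 * 2) (m%2≡bit0 m))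

bit0[b+e*2]≡b : ∀ b e → bit (fromBit b + e * 2) 0 ≡ b
bit0[b+e*2]≡b b e = fromBit-injective (begin
  fromBit (bit (fromBit b + e * 2) 0) ≡⟨ m%2≡bit0 (fromBit b + e * 2) ⟨
  (fromBit b + e * 2) % 2             ≡⟨ [m+kn]%n≡m%n (fromBit b) e 2 ⟩
  fromBit b % 2                       ≡⟨ m<n⇒m%n≡m (fromBit<2 b) ⟩
  fromBit b                           ∎)
  where open ≡.≡-Reasoning

[b+e*2]/2≡e : ∀ b e → (fromBit b + e * 2) / 2 ≡ e
[b+e*2]/2≡e b e = ≡.trans (+-distrib-/-∣ʳ (fromBit b) (n∣m*n e))
                          (cong₂ _+_ (m<n⇒m/n≡0 (fromBit<2 b)) (m*n/n≡m e 2))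

bit-injective : ∀ {m n} → m < 2 ^ N → n < 2 ^ N →
                (∀ (l : Fin N) → bit m (toℕ l) ≡ bit n (toℕ l)) → m ≡ n
bit-injective {zero} m<1 n<1 _ = ≡.trans (n<1⇒n≡0 m<1) (≡.sym (n<1⇒n≡0 n<1))
bit-injective {suc N} {m} {n} m<2^N n<2^N bits≡ = begin
  m                             ≡⟨ m≡bit0+[m/2]*2 m ⟩
  fromBit (bit m 0) + m / 2 * 2 ≡⟨ cong₂ (λ b e → fromBit b + e * 2) (bits≡ zero)
                                         (bit-injective (half< m<2^N) (half< n<2^N) (λ l → bits≡ (suc l))) ⟩
  fromBit (bit n 0) + n / 2 * 2 ≡⟨ m≡bit0+[m/2]*2 n ⟨
  n                             ∎
  where
  open ≡.≡-Reasoning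
  half< : ∀ {m} → m < 2 ^ suc N → m / 2 < 2 ^ N
  half< {m} m< = m<n*o⇒m/o<n (≡.subst (m <_) (*-comm 2 (2 ^ N)) m<)

bitsToℕ : (N : ℕ) → (ℕ → Bool) → ℕ
bitsToℕ zero    ρ = 0
bitsToℕ (suc N) ρ = fromBit (ρ 0) + bitsToℕ N (λ n → ρ (suc n)) * 2

bitsToℕ<2^N : (N : ℕ) (ρ : ℕ → Bool) → bitsToℕ N ρ < 2 ^ N
bitsToℕ<2^N zero    ρ = s≤s z≤n
bitsToℕ<2^N (suc N) ρ = begin-strict
  fromBit (ρ 0) + e * 2 <⟨ s≤s (+-monoˡ-≤ (e * 2) (≤-pred (fromBit<2 (ρ 0)))) ⟩
  suc e * 2             ≤⟨ *-monoˡ-≤ 2 (bitsToℕ<2^N N (λ n → ρ (suc n))) ⟩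
  2 ^ N * 2             ≡⟨ *-comm (2 ^ N) 2 ⟩
  2 ^ suc N             ∎
  where
  open ≤-Reasoning
  e : ℕ
  e = bitsToℕ N (λ n → ρ (suc n))

bit-bitsToℕ : (N : ℕ) (ρ : ℕ → Bool) (l : Fin N) → bit (bitsToℕ N ρ) (toℕ l) ≡ ρ (toℕ l)
bit-bitsToℕ (suc N) ρ zero    = bit0[b+e*2]≡b (ρ 0) (bitsToℕ N (λ n → ρ (suc n)))
bit-bitsToℕ (suc N) ρ (suc l) =
  ≡.trans (cong (λ n → bit n (toℕ l)) ([b+e*2]/2≡e (ρ 0) (bitsToℕ N (λ n → ρ (suc n)))))
          (bit-bitsToℕ N (λ n → ρ (suc n)) l)

minterm : (N : ℕ) → (ℕ → Bool) → Fin (2 ^ N)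
minterm N ρ = fromℕ< (bitsToℕ<2^N N ρ)

bit-minterm : (N : ℕ) (ρ : ℕ → Bool) (l : Fin N) → bit (toℕ (minterm N ρ)) (toℕ l) ≡ ρ (toℕ l)
bit-minterm N ρ l = ≡.trans (cong (λ n → bit n (toℕ l)) (toℕ-fromℕ< (bitsToℕ<2^N N ρ))) (bit-bitsToℕ N ρ l)

bits-injective : {j k : Fin (2 ^ N)} → (∀ (l : Fin N) → bit (toℕ j) (toℕ l) ≡ bit (toℕ k) (toℕ l)) → j ≡ k
bits-injective {j = j} {k} = toℕ-injective ∘′ bit-injective (toℕ<n j) (toℕ<n k)

minterm-bit : (N : ℕ) (k : Fin (2 ^ N)) → minterm N (bit (toℕ k)) ≡ k
minterm-bit N k = bits-injective (bit-minterm N (bit (toℕ k)))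

T-⟦foldr-·⟧ : {A : Set} (g : A → Tm M) (σ : Fin M → Bool) (as : List A) →
              T (⟦ foldr (λ a t → g a · t) 𝟙 as ⟧ σ) ⇔ All (λ a → T (⟦ g a ⟧ σ)) as
T-⟦foldr-·⟧ g σ []       = mk⇔ (const []) (const tt)
T-⟦foldr-·⟧ g σ (a ∷ as) = mk⇔
  (λ h → let (ga , gas) = to T-∧ h in ga ∷ to (T-⟦foldr-·⟧ g σ as) gas)
  (λ { (ga ∷ gas) → from T-∧ (ga , from (T-⟦foldr-·⟧ g σ as) gas) })

T-⟦foldr-∘⟧ : {A : Set} (g : A → Tm M) (σ : Fin M → Bool) (as : List A) →
              T (⟦ foldr (λ a t → g a ∘ t) θ as ⟧ σ) ⇔ Any (λ a → T (⟦ g a ⟧ σ)) as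
T-⟦foldr-∘⟧ g σ []       = mk⇔ (λ ()) (λ ())
T-⟦foldr-∘⟧ g σ (a ∷ as) = mk⇔
  (λ h → [ here , there ∘′ to (T-⟦foldr-∘⟧ g σ as) ]′ (to T-∨ h))
  (λ { (here ga) → from T-∨ (inj₁ ga) ; (there gas) → from T-∨ (inj₂ (from (T-⟦foldr-∘⟧ g σ as) gas)) })

T-⟦literal⟧ : (b : Bool) (l : Fin M) (σ : Fin M → Bool) → T (⟦ if b then x l else xc l ⟧ σ) ⇔ b ≡ σ l
T-⟦literal⟧ true  l σ = mk⇔ (≡.sym ∘′ to T-≡)     (from T-≡ ∘′ ≡.sym)
T-⟦literal⟧ false l σ = mk⇔ (≡.sym ∘′ to T-not-≡) (from T-not-≡ ∘′ ≡.sym)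

T-⟦y⟧ : (N : ℕ) (k : Fin (2 ^ N)) (σ : Fin N → Bool) → T (⟦ y N k ⟧ σ) ⇔ (∀ l → bit (toℕ k) (toℕ l) ≡ σ l)
T-⟦y⟧ N k σ = mk⇔
  (λ h l → to (T-⟦literal⟧ _ l σ) (All.tabulate⁻ (to (T-⟦foldr-·⟧ literal σ (allFin N)) h) l))
  (λ h → from (T-⟦foldr-·⟧ literal σ (allFin N)) (All.tabulate⁺ (λ l → from (T-⟦literal⟧ _ l σ) (h l))))
  where
  literal : Fin N → Tm N
  literal l = if bit (toℕ k) (toℕ l) then x l else xc l

T-⟦y⟧⇔minterm : (N : ℕ) (k : Fin (2 ^ N)) (ρ : ℕ → Bool) → T (⟦ y N k ⟧ (λ l → ρ (toℕ l))) ⇔ minterm N ρ ≡ k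
T-⟦y⟧⇔minterm N k ρ = mk⇔
  (λ h → bits-injective (λ l → ≡.trans (bit-minterm N ρ l) (≡.sym (to (T-⟦y⟧ N k _) h l))))
  (λ { ≡.refl → from (T-⟦y⟧ N (minterm N ρ) _) (bit-minterm N ρ) })

T-⟦elem⟧ : (N : ℕ) (D : Subset (2 ^ N)) (ρ : ℕ → Bool) → T (⟦ elem N D ⟧ᴱ ρ) ⇔ minterm N ρ ∈ D
T-⟦elem⟧ N D ρ = mk⇔
  (λ h → proj₂ (∈-filter⁻ (_∈? D) {xs = allFin (2 ^ N)}
                  (Any.map (to (T-⟦y⟧⇔minterm N _ ρ)) (to (T-⟦foldr-∘⟧ (y N) _ _) h))))
  (λ m∈D → from (T-⟦foldr-∘⟧ (y N) _ _)
             (Any.map (from (T-⟦y⟧⇔minterm N _ ρ)) (∈-filter⁺ (_∈? D) (∈-allFin (minterm N ρ)) m∈D)))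

∈-⋂-tabulate : {n : ℕ} {i : Fin n} (Bs : Fin k → Subset n) → i ∈ ⋂ (tabulate Bs) ⇔ (∀ j → i ∈ Bs j)
∈-⋂-tabulate {zero}  Bs = mk⇔ (λ _ ()) (const ∈⊤)
∈-⋂-tabulate {suc k} Bs = mk⇔
  (λ h → λ { zero → proj₁ (x∈p∩q⁻ _ _ h) ; (suc j) → to (∈-⋂-tabulate (λ j → Bs (suc j))) (proj₂ (x∈p∩q⁻ _ _ h)) j })
  (λ h → x∈p∩q⁺ (h zero , from (∈-⋂-tabulate (λ j → Bs (suc j))) (λ j → h (suc j))))

elem-⊨⇔⊆ : (N : ℕ) (Bs : Fin k → Subset (2 ^ N)) (B : Subset (2 ^ N)) →
           (λ i → elem N (Bs i)) ⊨ elem N B ⇔ ⋂ (tabulate Bs) ⊆ B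
elem-⊨⇔⊆ N Bs B = mk⇔ ⊨⇒⊆ ⊆⇒⊨
  where
  ⊨⇒⊆ : (λ i → elem N (Bs i)) ⊨ elem N B → ⋂ (tabulate Bs) ⊆ B
  ⊨⇒⊆ ⊨β {j} j∈⋂ = ≡.subst (_∈ B) (minterm-bit N j) (to (T-⟦elem⟧ N B ρⱼ) (⊨β ρⱼ (λ i →
    from (T-⟦elem⟧ N (Bs i) ρⱼ) (≡.subst (_∈ Bs i) (≡.sym (minterm-bit N j)) (to (∈-⋂-tabulate Bs) j∈⋂ i)))))
    where
    ρⱼ : ℕ → Bool
    ρⱼ = bit (toℕ j)
  ⊆⇒⊨ : ⋂ (tabulate Bs) ⊆ B → (λ i → elem N (Bs i)) ⊨ elem N B
  ⊆⇒⊨ ⋂⊆B ρ ⊨Γ = from (T-⟦elem⟧ N B ρ) (⋂⊆B (from (∈-⋂-tabulate Bs) (λ i → to (T-⟦elem⟧ N (Bs i) ρ) (⊨Γ i))))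

corollary4p11 : (N : ℕ) → 1 ≤ N → (k : ℕ) → (Bs : Fin k → Subset (2 ^ N)) → (B : Subset (2 ^ N)) →
    (((λ i → elem N (Bs i)) ⊢ elem N B) → ⋂ (tabulate Bs) ⊆ B)
    × (⋂ (tabulate Bs) ⊆ B → ((λ i → elem N (Bs i)) ⊢ elem N B))
corollary4p11 N _ k Bs B = to ⊢⇔⋂⊆ , from ⊢⇔⋂⊆
  where
  ⊢⇔⋂⊆ : (λ i → elem N (Bs i)) ⊢ elem N B ⇔ ⋂ (tabulate Bs) ⊆ B
  ⊢⇔⋂⊆ = elem-⊨⇔⊆ N Bs B ⇔-∘ ⊢⇔⊨
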